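{- Let $t,s,c,\gamma$ be positive integers. With $\sigma=1$, the optimal number of dinners of the Business Dinner Problem is $$r(t,s,c,1,\gamma)=\max\left(s,\left\lceil\frac c \gamma\right\rceil,\left\lceil\frac s t\left\lceil \frac c \gamma\right\rceil\right\rceil\right).$$
   Context: Business Dinner Problem: given positive integers $t$ (number of tables), $s$ (suppliers), $c$ (customers), $\sigma$ and $\gamma$. A schedule is a finite sequence of dinners; in each dinner, each participant (supplier or customer) sits at at most one of the $t$ tables (participants may be absent from a dinner), and each table hosts at most $\sigma$ suppliers and at most $\gamma$ customers. The schedule is feasible if (i) any two distinct suppliers sit at the same table in at most one dinner, and (ii) every customer and every supplier sit at the same table in exactly one dinner. $r(t,s,c,\sigma,\gamma)$ is the minimum number of dinners of a feasible schedule. -}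

module Defs where

open import Data.Nat using (ℕ; zero; suc; _+_; _∸_; _≤_; _⊔_; NonZero)
open import Data.Nat.DivMod using (_/_)
open import Data.Fin using (Fin; zero; suc; _≟_)
open import Data.Maybe using (Maybe; just; nothing)
open import Data.Bool using (Bool; true; false; if_then_else_)
open import Data.List using (List; length)
open import Data.Product using (_×_; Σ)
open import Data.List.Relation.Unary.All using (All)
open import Relation.Nullary.Decidable using (⌊_⌋)
open import Relation.Binary.PropositionalEquality using (_≡_; _≢_)

countFin : (n : ℕ) → (Fin n → Bool) → ℕ
countFin zero    p = 0
countFin (suc n) p = (if p zero then 1 else 0) + countFin n (λ i → p (suc i))

countList : {A : Set} → (A → Bool) → List A → ℕ
countList p List.[] = 0
countList p (x List.∷ xs) = (if p x then 1 else 0) + countList p xs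

⌈_/_⌉ : (a b : ℕ) → .{{NonZero b}} → ℕ
⌈ a / b ⌉ = (a + (b ∸ 1)) / b

-- one dinner: each supplier/customer is either absent (nothing) or at a table
record Dinner (t s c : ℕ) : Set where
  field
    supSeat  : Fin s → Maybe (Fin t)
    custSeat : Fin c → Maybe (Fin t)
open Dinner public

Schedule : (t s c : ℕ) → Set
Schedule t s c = List (Dinner t s c)

sameTable : {t : ℕ} → Maybe (Fin t) → Maybe (Fin t) → Bool
sameTable (just a) (just b) = ⌊ a ≟ b ⌋
sameTable _        _        = false

atTable : {t : ℕ} → Fin t → Maybe (Fin t) → Bool
atTable k (just a) = ⌊ a ≟ k ⌋
atTable k nothing  = false

RespectsCapacity : {t s c : ℕ} → (σ γ : ℕ) → Dinner t s c → Set
RespectsCapacity {t} {s} {c} σ γ d =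
  (k : Fin t) →
    (countFin s (λ i → atTable k (supSeat d i)) ≤ σ) × (countFin c (λ j → atTable k (custSeat d j)) ≤ γ)

supMeetings : {t s c : ℕ} → Schedule t s c → Fin s → Fin s → ℕ
supMeetings S i i' = countList (λ d → sameTable (supSeat d i) (supSeat d i')) S

scMeetings : {t s c : ℕ} → Schedule t s c → Fin s → Fin c → ℕ
scMeetings S i j = countList (λ d → sameTable (supSeat d i) (custSeat d j)) S


Feasible : {t s c : ℕ} → (σ γ : ℕ) → Schedule t s c → Set
Feasible {t} {s} {c} σ γ S =
  All (RespectsCapacity σ γ) S
  × ((i i' : Fin s) → i ≢ i' → supMeetings S i i' ≤ 1)
  × ((i : Fin s) (j : Fin c) → scMeetings S i j ≡ 1)

IsOptimalDinnerCount : (t s c σ γ m : ℕ) → Set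
IsOptimalDinnerCount t s c σ γ m =
  (Σ (Schedule t s c) (λ S → Feasible σ γ S × length S ≡ m))
  × ((S : Schedule t s c) → Feasible σ γ S → m ≤ length S)

module Submission where

open import Defs
open import Data.Bool using (Bool; true; false; if_then_else_; T)
open import Data.Bool.Properties using (T-≡)
open import Data.Fin using (Fin; zero; suc; toℕ; fromℕ<)
open import Data.Fin.Properties using (toℕ<n; toℕ-injective; toℕ-fromℕ<; any?)
open import Data.List using (List; []; _∷_; length; applyDownFrom)
open import Data.List.Properties using (length-applyDownFrom)
open import Data.List.Relation.Unary.All using (All; []; _∷_)
open import Data.List.Relation.Unary.All.Properties using (applyDownFrom⁺₂)
open import Data.Maybe using (Maybe; just; nothing; is-just)
open import Data.Nat
open import Data.Nat.DivMod
open import Data.Nat.Divisibility using (n∣m*n)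
open import Data.Nat.Properties
open import Data.Product using (Σ; _×_; _,_; proj₁; proj₂)
open import Data.Sum using (inj₁; inj₂)
open import Function using (_∘_; Equivalence)
open import Relation.Nullary using (¬_; yes; no; contradiction)
open import Relation.Nullary.Decidable using (T?; toWitness; fromWitness)
open import Relation.Binary.PropositionalEquality
open import Algebra.Properties.Semiring.Sum +-*-semiring
  using (sum-syntax; sum-cong-≗; sum-remove; ∑-distrib-+; ∑-comm)

-- Lower bound, by double counting: a customer meets all s suppliers, at most one
-- per dinner; a supplier meets at most γ customers per dinner he attends, so he
-- attends at least ⌈c/γ⌉ dinners; and a dinner seats at most t suppliers.
--
-- Upper bound: split the customers into m = ⌈c/γ⌉ groups of at most γ, let r be
-- the claimed value, and give group g the offset ⌊g r / m⌋ < r.  Supplier i meets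
-- group g at dinner (offset g + i) mod r, at table x mod t, where x ∈ {g, g + m}
-- is the copy of g whose offset lies in (d, d + r] (offset (g + m) = offset g + r).
-- Since s m ≤ r t, offsets grow by at least s over t consecutive copies, so the
-- copies present at one dinner are less than t apart and get pairwise distinct
-- tables.

-- Division

m<m/n*n+n : ∀ m n .{{_ : NonZero n}} → m < m / n * n + n
m<m/n*n+n m n = begin-strict
  m                  ≡⟨ m≡m%n+[m/n]*n m n ⟩
  m % n + m / n * n  <⟨ +-monoˡ-< (m / n * n) (m%n<n m n) ⟩
  n + m / n * n      ≡⟨ +-comm n _ ⟩
  m / n * n + n      ∎
  where open ≤-Reasoning

m≤o*n⇒⌈m/n⌉≤o : ∀ {m n o} .{{_ : NonZero n}} → m ≤ o * n → ⌈ m / n ⌉ ≤ o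
m≤o*n⇒⌈m/n⌉≤o {m} {n@(suc n-1)} {o} m≤o*n = ≤-pred (m<n*o⇒m/o<n (begin-strict
  m + n-1    <⟨ +-mono-≤-< m≤o*n (n<1+n n-1) ⟩
  o * n + n  ≡⟨ +-comm (o * n) n ⟩
  suc o * n  ∎))
  where open ≤-Reasoning

m≤⌈m/n⌉*n : ∀ m n .{{_ : NonZero n}} → m ≤ ⌈ m / n ⌉ * n
m≤⌈m/n⌉*n m n@(suc n-1) =
  +-cancelʳ-≤ n-1 m _ (≤-pred (subst (m + n-1 <_) (+-suc _ n-1) (m<m/n*n+n (m + n-1) n)))

⌈m/n⌉>0 : ∀ {m n} .{{_ : NonZero n}} → m > 0 → ⌈ m / n ⌉ > 0
⌈m/n⌉>0 {m} {n@(suc n-1)} m>0 = m≥n⇒m/n>0 (+-monoˡ-≤ n-1 m>0)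

/-unique : ∀ {m n q} .{{_ : NonZero n}} → q * n ≤ m → m < q * n + n → m / n ≡ q
/-unique {m} {n} {q} lo hi = begin
  m / n                          ≡⟨ /-congˡ (sym (m+[n∸m]≡n lo)) ⟩
  (q * n + (m ∸ q * n)) / n      ≡⟨ +-distrib-/-∣ˡ (m ∸ q * n) (n∣m*n q) ⟩
  q * n / n + (m ∸ q * n) / n    ≡⟨ cong₂ _+_ (m*n/n≡m q n) (m<n⇒m/n≡0 rem<n) ⟩
  q + 0                          ≡⟨ +-identityʳ q ⟩
  q                              ∎
  where
  open ≡-Reasoning
  rem<n : m ∸ q * n < n
  rem<n = +-cancelˡ-< (q * n) _ _ (subst (_< q * n + n) (sym (m+[n∸m]≡n lo)) hi)

⌈m/n⌉≡o : ∀ {m n o} .{{_ : NonZero n}} → m ≤ o * n → o * n < m + n → ⌈ m / n ⌉ ≡ o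
⌈m/n⌉≡o {m} {n@(suc n-1)} {o} lo hi =
  /-unique (≤-pred (subst (o * n <_) (+-suc m n-1) hi)) (+-mono-≤-< lo (n<1+n n-1))

%-window-injective : ∀ {x y n} .{{_ : NonZero n}} → x ≤ y → y < x + n → x % n ≡ y % n → x ≡ y
%-window-injective {x} {y} {n} x≤y y<x+n x≡y[n] = begin-equality
  x                  ≡⟨ m≡m%n+[m/n]*n x n ⟩
  x % n + x / n * n  ≡⟨ cong₂ (λ ρ q → ρ + q * n) x≡y[n] x/n≡y/n ⟩
  y % n + y / n * n  ≡⟨ sym (m≡m%n+[m/n]*n y n) ⟩
  y                  ∎
  where
  open ≤-Reasoning
  x%n+y/n*n<x%n+[1+x/n]*n : x % n + y / n * n < x % n + suc (x / n) * n
  x%n+y/n*n<x%n+[1+x/n]*n = begin-strict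
    x % n + y / n * n        ≡⟨ cong (_+ y / n * n) x≡y[n] ⟩
    y % n + y / n * n        ≡⟨ sym (m≡m%n+[m/n]*n y n) ⟩
    y                        <⟨ y<x+n ⟩
    x + n                    ≡⟨ cong (_+ n) (m≡m%n+[m/n]*n x n) ⟩
    x % n + x / n * n + n    ≡⟨ +-assoc (x % n) _ n ⟩
    x % n + (x / n * n + n)  ≡⟨ cong (x % n +_) (+-comm _ n) ⟩
    x % n + suc (x / n) * n  ∎
  x/n≡y/n : x / n ≡ y / n
  x/n≡y/n = ≤-antisym (/-monoˡ-≤ n x≤y)
    (≤-pred (*-cancelʳ-< n (y / n) (suc (x / n)) (+-cancelˡ-< (x % n) _ _ x%n+y/n*n<x%n+[1+x/n]*n)))

mod≡⇒%≡ : ∀ {x y n} .{{_ : NonZero n}} → x mod n ≡ y mod n → x % n ≡ y % n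
mod≡⇒%≡ {x} {y} {n} eq =
  trans (sym (toℕ-fromℕ< (m%n<n x n))) (trans (cong toℕ eq) (toℕ-fromℕ< (m%n<n y n)))

-- Counting

⟦_⟧ : Bool → ℕ
⟦ b ⟧ = if b then 1 else 0

∑-const : ∀ n k → ∑[ i < n ] k ≡ n * k
∑-const zero    k = refl
∑-const (suc n) k = cong (k +_) (∑-const n k)

∑-mono-≤ : ∀ n {f g : Fin n → ℕ} → (∀ i → f i ≤ g i) → ∑[ i < n ] f i ≤ ∑[ i < n ] g i
∑-mono-≤ zero    f≤g = z≤n
∑-mono-≤ (suc n) f≤g = +-mono-≤ (f≤g zero) (∑-mono-≤ n (f≤g ∘ suc))

term≤∑ : ∀ {n} (f : Fin n → ℕ) i → f i ≤ ∑[ j < n ] f j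
term≤∑ {suc n} f i = ≤-trans (m≤m+n (f i) _) (≤-reflexive (sym (sum-remove {i = i} f)))

countFin≡∑ : ∀ n (p : Fin n → Bool) → countFin n p ≡ ∑[ i < n ] ⟦ p i ⟧
countFin≡∑ zero    p = refl
countFin≡∑ (suc n) p = cong (⟦ p zero ⟧ +_) (countFin≡∑ n (p ∘ suc))

countFin-none : ∀ n (p : Fin n → Bool) → (∀ i → ¬ T (p i)) → countFin n p ≡ 0
countFin-none zero    p none = refl
countFin-none (suc n) p none with p zero | none zero
... | true  | ¬p₀ = contradiction _ ¬p₀
... | false | _   = countFin-none n (p ∘ suc) (none ∘ suc)

countFin-mono : ∀ n (p q : Fin n → Bool) → (∀ i → T (p i) → T (q i)) → countFin n p ≤ countFin n q
countFin-mono zero    p q p⇒q = z≤n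
countFin-mono (suc n) p q p⇒q with p zero | q zero | p⇒q zero
... | true  | true  | _    = s≤s (countFin-mono n (p ∘ suc) (q ∘ suc) (p⇒q ∘ suc))
... | true  | false | p₀⇒ = contradiction _ p₀⇒
... | false | true  | _    = m≤n⇒m≤1+n (countFin-mono n (p ∘ suc) (q ∘ suc) (p⇒q ∘ suc))
... | false | false | _    = countFin-mono n (p ∘ suc) (q ∘ suc) (p⇒q ∘ suc)

countFin-interval : ∀ n (p : Fin n → Bool) a b →
  (∀ i → T (p i) → a ≤ toℕ i × toℕ i < a + b) → countFin n p ≤ b
countFin-interval zero    p a b inside = z≤n
countFin-interval (suc n) p a b inside with p zero | inside zero
... | false | _ = countFin-interval n (p ∘ suc) (pred a) b (λ i → shift ∘ inside (suc i))
  where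
  shift : ∀ {a x} → a ≤ suc x × suc x < a + b → pred a ≤ x × x < pred a + b
  shift {zero}  (_ , 1+x<b)        = z≤n , <-trans (n<1+n _) 1+x<b
  shift {suc a} (s≤s a≤x , s≤s x<) = a≤x , x<
... | true | in₀ with in₀ _
...   | z≤n , 0<b = ≤-trans (s≤s (countFin-interval n (p ∘ suc) 0 (pred b) tail))
                            (≤-reflexive (suc-pred b {{>-nonZero 0<b}}))
  where
  tail : ∀ i → T (p (suc i)) → 0 ≤ toℕ i × toℕ i < pred b
  tail i pᵢ = z≤n , <⇒≤pred (proj₂ (inside (suc i) pᵢ))

countFin-block : ∀ n (p : Fin n → Bool) b .{{_ : NonZero b}} →
  (∀ i i′ → T (p i) → T (p i′) → toℕ i / b ≡ toℕ i′ / b) → countFin n p ≤ b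
countFin-block n p b sameBlock with any? (λ i → T? (p i))
... | no ∄ = ≤-trans (≤-reflexive (countFin-none n p (λ i pᵢ → ∄ (i , pᵢ)))) z≤n
... | yes (i₀ , pᵢ₀) = countFin-interval n p (toℕ i₀ / b * b) b λ i pᵢ →
  let i/b≡i₀/b = sameBlock i i₀ pᵢ pᵢ₀ in
  subst (λ q → q * b ≤ toℕ i) i/b≡i₀/b (m/n*n≤m (toℕ i) b) ,
  subst (λ q → toℕ i < q * b + b) i/b≡i₀/b (m<m/n*n+n (toℕ i) b)

countFin-atMostOne : ∀ n (p : Fin n → Bool) → (∀ i i′ → T (p i) → T (p i′) → i ≡ i′) → countFin n p ≤ 1
countFin-atMostOne n p unique =
  countFin-block n p 1 λ i i′ pᵢ pᵢ′ → cong (λ k → toℕ k / 1) (unique i i′ pᵢ pᵢ′)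

countList≤length : {A : Set} (p : A → Bool) (S : List A) → countList p S ≤ length S
countList≤length p []      = z≤n
countList≤length p (d ∷ S) with p d
... | true  = s≤s (countList≤length p S)
... | false = m≤n⇒m≤1+n (countList≤length p S)

countList-true : {A : Set} (S : List A) → countList (λ _ → true) S ≡ length S
countList-true []      = refl
countList-true (d ∷ S) = cong suc (countList-true S)

countList-applyDownFrom-none : {A : Set} (p : A → Bool) (f : ℕ → A) (n : ℕ) →
  (∀ {d} → d < n → ¬ T (p (f d))) → countList p (applyDownFrom f n) ≡ 0
countList-applyDownFrom-none p f zero    none = refl
countList-applyDownFrom-none p f (suc n) none with p (f n) | none (n<1+n n)
... | true  | ¬pₙ = contradiction _ ¬pₙ
... | false | _   = countList-applyDownFrom-none p f n (none ∘ m<n⇒m<1+n)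

countList-applyDownFrom-unique : {A : Set} (p : A → Bool) (f : ℕ → A) {n d₀ : ℕ} →
  d₀ < n → T (p (f d₀)) → (∀ {d} → d < n → T (p (f d)) → d ≡ d₀) →
  countList p (applyDownFrom f n) ≡ 1
countList-applyDownFrom-unique p f {suc n} {d₀} d₀<1+n pd₀ unique with p (f n) in pₙ
... | true  = cong suc (countList-applyDownFrom-none p f n λ d<n pd →
                <⇒≢ d<n (trans (unique (m<n⇒m<1+n d<n) pd) (sym (unique (n<1+n n) (subst T (sym pₙ) _)))))
... | false = countList-applyDownFrom-unique p f d₀<n pd₀ (unique ∘ m<n⇒m<1+n)
  where
  d₀<n : d₀ < n
  d₀<n = ≤∧≢⇒< (≤-pred d₀<1+n) λ { refl → subst T pₙ pd₀ }

∑-countList-∷ : ∀ {A : Set} n (q : Fin n → A → Bool) d S →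
  ∑[ i < n ] countList (q i) (d ∷ S) ≡ countFin n (λ i → q i d) + ∑[ i < n ] countList (q i) S
∑-countList-∷ n q d S = begin
  ∑[ i < n ] (⟦ q i d ⟧ + countList (q i) S)            ≡⟨ ∑-distrib-+ (λ i → ⟦ q i d ⟧) _ ⟩
  ∑[ i < n ] ⟦ q i d ⟧ + ∑[ i < n ] countList (q i) S   ≡⟨ cong (_+ _) (sym (countFin≡∑ n _)) ⟩
  countFin n (λ i → q i d) + ∑[ i < n ] countList (q i) S ∎
  where open ≡-Reasoning

∑-countList≤ : ∀ {A : Set} {P : A → Set} n (q : Fin n → A → Bool) (p : A → Bool) b {S : List A} →
  All P S → (∀ {d} → P d → countFin n (λ i → q i d) ≤ ⟦ p d ⟧ * b) →
  ∑[ i < n ] countList (q i) S ≤ countList p S * b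
∑-countList≤ n q p b []                 bound = ≤-reflexive (trans (∑-const n 0) (*-zeroʳ n))
∑-countList≤ n q p b {d ∷ S} (Pd ∷ PS) bound = begin
  ∑[ i < n ] countList (q i) (d ∷ S)                       ≡⟨ ∑-countList-∷ n q d S ⟩
  countFin n (λ i → q i d) + ∑[ i < n ] countList (q i) S  ≤⟨ +-mono-≤ (bound Pd) (∑-countList≤ n q p b PS bound) ⟩
  ⟦ p d ⟧ * b + countList p S * b                          ≡⟨ sym (*-distribʳ-+ b ⟦ p d ⟧ (countList p S)) ⟩
  countList p (d ∷ S) * b                                  ∎
  where open ≤-Reasoning

∑-countList≤length : ∀ {A : Set} {P : A → Set} n (q : Fin n → A → Bool) b {S : List A} →
  All P S → (∀ {d} → P d → countFin n (λ i → q i d) ≤ b) →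
  ∑[ i < n ] countList (q i) S ≤ length S * b
∑-countList≤length n q b {S} PS bound = begin
  ∑[ i < n ] countList (q i) S  ≤⟨ ∑-countList≤ n q (λ _ → true) b PS
                                      (λ Pd → ≤-trans (bound Pd) (≤-reflexive (sym (*-identityˡ b)))) ⟩
  countList (λ _ → true) S * b  ≡⟨ cong (_* b) (countList-true S) ⟩
  length S * b                  ∎
  where open ≤-Reasoning

sameTable⇒just : ∀ {t} {x y : Maybe (Fin t)} → T (sameTable x y) → Σ (Fin t) λ k → x ≡ just k × y ≡ just k
sameTable⇒just {x = just a} {just b} a≡b with toWitness a≡b
... | refl = a , refl , refl

sameTable-refl : ∀ {t} (k : Fin t) → T (sameTable (just k) (just k))
sameTable-refl k = fromWitness refl

sameTable-nothingʳ : ∀ {t} (x : Maybe (Fin t)) → ¬ T (sameTable x nothing)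
sameTable-nothingʳ (just _) ()
sameTable-nothingʳ nothing  ()

sameTable-justʳ : ∀ {t} {k : Fin t} x → T (sameTable x (just k)) → T (atTable k x)
sameTable-justʳ (just a) a≡k = a≡k

sameTable-justˡ : ∀ {t} {k : Fin t} x → T (sameTable (just k) x) → T (atTable k x)
sameTable-justˡ (just a) k≡a = fromWitness (sym (toWitness k≡a))

atTable⇒≡just : ∀ {t} {k : Fin t} x → T (atTable k x) → x ≡ just k
atTable⇒≡just (just a) a≡k = cong just (toWitness a≡k)

is-just≤∑atTable : ∀ {t} (x : Maybe (Fin t)) → ⟦ is-just x ⟧ ≤ ∑[ k < t ] ⟦ atTable k x ⟧
is-just≤∑atTable nothing  = z≤n
is-just≤∑atTable {t} (just a) = begin
  1                               ≡⟨ cong ⟦_⟧ (Equivalence.to T-≡ (sameTable-refl a)) ⟨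
  ⟦ atTable a (just a) ⟧          ≤⟨ term≤∑ (λ k → ⟦ atTable k (just a) ⟧) a ⟩
  ∑[ k < t ] ⟦ atTable k (just a) ⟧ ∎
  where open ≤-Reasoning

module _ {n t b : ℕ} (f : Fin n → Maybe (Fin t)) (cap : ∀ k → countFin n (λ i → atTable k (f i)) ≤ b) where

  countFin-sameTableˡ≤ : ∀ y → countFin n (λ i → sameTable (f i) y) ≤ b
  countFin-sameTableˡ≤ nothing  = ≤-trans (≤-reflexive (countFin-none n _ (sameTable-nothingʳ ∘ f))) z≤n
  countFin-sameTableˡ≤ (just k) = ≤-trans (countFin-mono n _ _ (sameTable-justʳ ∘ f)) (cap k)

  countFin-sameTableʳ≤ : ∀ x → countFin n (λ i → sameTable x (f i)) ≤ ⟦ is-just x ⟧ * b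
  countFin-sameTableʳ≤ nothing  = ≤-reflexive (countFin-none n _ λ i ())
  countFin-sameTableʳ≤ (just k) =
    ≤-trans (countFin-mono n _ _ (sameTable-justˡ ∘ f)) (≤-trans (cap k) (≤-reflexive (sym (*-identityˡ b))))

  countFin-is-just≤ : countFin n (λ i → is-just (f i)) ≤ t * b
  countFin-is-just≤ = begin
    countFin n (λ i → is-just (f i))               ≡⟨ countFin≡∑ n _ ⟩
    ∑[ i < n ] ⟦ is-just (f i) ⟧                   ≤⟨ ∑-mono-≤ n (is-just≤∑atTable ∘ f) ⟩
    ∑[ i < n ] ∑[ k < t ] ⟦ atTable k (f i) ⟧      ≡⟨ ∑-comm (λ i k → ⟦ atTable k (f i) ⟧) ⟩
    ∑[ k < t ] ∑[ i < n ] ⟦ atTable k (f i) ⟧      ≡⟨ sum-cong-≗ (λ k → sym (countFin≡∑ n (λ i → atTable k (f i)))) ⟩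
    ∑[ k < t ] countFin n (λ i → atTable k (f i))  ≤⟨ ∑-mono-≤ t cap ⟩
    ∑[ k < t ] b                                   ≡⟨ ∑-const t b ⟩
    t * b                                          ∎
    where open ≤-Reasoning

-- Lower bound

module LowerBound {t s c σ γ : ℕ} (S : Schedule t s c) (feasible : Feasible σ γ S) where

  private
    capacities : All (RespectsCapacity σ γ) S
    capacities = proj₁ feasible

    meetsOnce : ∀ i j → scMeetings S i j ≡ 1
    meetsOnce = proj₂ (proj₂ feasible)

  attendance : Fin s → ℕ
  attendance i = countList (λ d → is-just (supSeat d i)) S

  s≤length*σ : Fin c → s ≤ length S * σ
  s≤length*σ j = begin
    s                            ≡⟨ sym (trans (∑-const s 1) (*-identityʳ s)) ⟩
    ∑[ i < s ] 1                 ≡⟨ sum-cong-≗ (λ i → sym (meetsOnce i j)) ⟩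
    ∑[ i < s ] scMeetings S i j  ≤⟨ ∑-countList≤length s (λ i d → sameTable (supSeat d i) (custSeat d j)) σ capacities
                                      (λ {d} cap → countFin-sameTableˡ≤ (supSeat d) (proj₁ ∘ cap) (custSeat d j)) ⟩
    length S * σ                 ∎
    where open ≤-Reasoning

  c≤attendance*γ : ∀ i → c ≤ attendance i * γ
  c≤attendance*γ i = begin
    c                            ≡⟨ sym (trans (∑-const c 1) (*-identityʳ c)) ⟩
    ∑[ j < c ] 1                 ≡⟨ sum-cong-≗ (λ j → sym (meetsOnce i j)) ⟩
    ∑[ j < c ] scMeetings S i j  ≤⟨ ∑-countList≤ c (λ j d → sameTable (supSeat d i) (custSeat d j))
                                      (λ d → is-just (supSeat d i)) γ capacities
                                      (λ {d} cap → countFin-sameTableʳ≤ (custSeat d) (proj₂ ∘ cap) (supSeat d i)) ⟩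
    attendance i * γ             ∎
    where open ≤-Reasoning

  ∑attendance≤ : ∑[ i < s ] attendance i ≤ length S * (t * σ)
  ∑attendance≤ = ∑-countList≤length s (λ i d → is-just (supSeat d i)) (t * σ) capacities
                   (λ {d} cap → countFin-is-just≤ (supSeat d) (proj₁ ∘ cap))

lowerBound : ∀ {t s c γ} .{{_ : NonZero t}} .{{_ : NonZero s}} .{{_ : NonZero c}} .{{_ : NonZero γ}} →
  (S : Schedule t s c) → Feasible 1 γ S → s ⊔ ⌈ c / γ ⌉ ⊔ ⌈ s * ⌈ c / γ ⌉ / t ⌉ ≤ length S
lowerBound {t} {s} {c} {γ} S feasible = ⊔-lub (⊔-lub s≤length m≤length) (m≤o*n⇒⌈m/n⌉≤o s*m≤length*t)
  where
  open LowerBound S feasible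
  open ≤-Reasoning
  s≤length : s ≤ length S
  s≤length = subst (s ≤_) (*-identityʳ _) (s≤length*σ (fromℕ< (>-nonZero⁻¹ c)))
  m≤length : ⌈ c / γ ⌉ ≤ length S
  m≤length = ≤-trans (m≤o*n⇒⌈m/n⌉≤o (c≤attendance*γ (fromℕ< (>-nonZero⁻¹ s)))) (countList≤length _ S)
  s*m≤length*t : s * ⌈ c / γ ⌉ ≤ length S * t
  s*m≤length*t = begin
    s * ⌈ c / γ ⌉            ≡⟨ sym (∑-const s _) ⟩
    ∑[ i < s ] ⌈ c / γ ⌉     ≤⟨ ∑-mono-≤ s (λ i → m≤o*n⇒⌈m/n⌉≤o (c≤attendance*γ i)) ⟩
    ∑[ i < s ] attendance i  ≤⟨ ∑attendance≤ ⟩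
    length S * (t * 1)       ≡⟨ cong (length S *_) (*-identityʳ t) ⟩
    length S * t             ∎

-- Construction

module Construction (t s c γ m r : ℕ) .{{_ : NonZero t}} .{{_ : NonZero γ}} .{{_ : NonZero m}} .{{_ : NonZero r}}
  (s≤r : s ≤ r) (m≤r : m ≤ r) (s*m≤r*t : s * m ≤ r * t) (c≤m*γ : c ≤ m * γ) where

  offset : ℕ → ℕ
  offset x = x * r / m

  offset-+m : ∀ x → offset (x + m) ≡ offset x + r
  offset-+m x = begin
    (x + m) * r / m        ≡⟨ /-congˡ (trans (*-distribʳ-+ r x m) (cong (x * r +_) (*-comm m r))) ⟩
    (x * r + r * m) / m    ≡⟨ +-distrib-/-∣ʳ (x * r) (n∣m*n r) ⟩
    offset x + r * m / m   ≡⟨ cong (offset x +_) (m*n/n≡m r m) ⟩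
    offset x + r           ∎
    where open ≡-Reasoning

  offset-mono-≤ : ∀ {x y} → x ≤ y → offset x ≤ offset y
  offset-mono-≤ x≤y = /-monoˡ-≤ m (*-monoˡ-≤ r x≤y)

  offset+s≤offset[+t] : ∀ x → offset x + s ≤ offset (x + t)
  offset+s≤offset[+t] x = begin
    offset x + s            ≡⟨ cong (offset x +_) (sym (m*n/n≡m s m)) ⟩
    offset x + s * m / m    ≡⟨ sym (+-distrib-/-∣ʳ (x * r) (n∣m*n s)) ⟩
    (x * r + s * m) / m     ≤⟨ /-monoˡ-≤ m (+-monoʳ-≤ (x * r) (≤-trans s*m≤r*t (≤-reflexive (*-comm r t)))) ⟩
    (x * r + t * r) / m     ≡⟨ /-congˡ (sym (*-distribʳ-+ r x t)) ⟩
    offset (x + t)          ∎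
    where open ≤-Reasoning

  offset<r : ∀ {g} → g < m → offset g < r
  offset<r {g} g<m = m<n*o⇒m/o<n (subst (g * r <_) (*-comm m r) (*-monoˡ-< r g<m))

  offset⁻¹ : ℕ → ℕ
  offset⁻¹ v = ⌈ v * m / r ⌉

  offset⁻¹-offset : ∀ x → offset⁻¹ (offset x) ≡ x
  offset⁻¹-offset x = ⌈m/n⌉≡o (m/n*n≤m (x * r) m) (<-≤-trans (m<m/n*n+n (x * r) m) (+-monoʳ-≤ _ m≤r))

  offset-gap : ∀ {x x′ i i′} → i < s → x + t ≤ x′ → offset x + i < offset x′ + i′
  offset-gap {x} {x′} {i} {i′} i<s x+t≤x′ = begin-strict
    offset x + i    <⟨ +-monoʳ-< (offset x) i<s ⟩
    offset x + s    ≤⟨ offset+s≤offset[+t] x ⟩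
    offset (x + t)  ≤⟨ offset-mono-≤ x+t≤x′ ⟩
    offset x′       ≤⟨ m≤m+n _ i′ ⟩
    offset x′ + i′  ∎
    where open ≤-Reasoning

  offset-window-injective-≤ : ∀ {x x′ i i′} → i < s → x ≤ x′ →
    offset x + i ≡ offset x′ + i′ → x % t ≡ x′ % t → x ≡ x′
  offset-window-injective-≤ {x} {x′} i<s x≤x′ eq x≡x′[t] with x′ <? x + t
  ... | yes x′<x+t = %-window-injective x≤x′ x′<x+t x≡x′[t]
  ... | no  x′≮x+t = contradiction eq (<⇒≢ (offset-gap i<s (≮⇒≥ x′≮x+t)))

  offset-window-injective : ∀ {x x′ i i′} → i < s → i′ < s →
    offset x + i ≡ offset x′ + i′ → x % t ≡ x′ % t → x ≡ x′
  offset-window-injective {x} {x′} i<s i′<s eq x≡x′[t] with ≤-total x x′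
  ... | inj₁ x≤x′ = offset-window-injective-≤ i<s x≤x′ eq x≡x′[t]
  ... | inj₂ x′≤x = sym (offset-window-injective-≤ i′<s x′≤x (sym eq) (sym x≡x′[t]))

  tableAt : ℕ → Maybe (Fin t)
  tableAt v with offset (offset⁻¹ v) ≟ v
  ... | yes _ = just (offset⁻¹ v mod t)
  ... | no  _ = nothing

  tableAt-offset : ∀ x → tableAt (offset x) ≡ just (x mod t)
  tableAt-offset x with offset (offset⁻¹ (offset x)) ≟ offset x
  ... | yes _ = cong (λ y → just (y mod t)) (offset⁻¹-offset x)
  ... | no  ≢ = contradiction (cong offset (offset⁻¹-offset x)) ≢

  tableAt≡just : ∀ {v k} → tableAt v ≡ just k → Σ ℕ λ x → offset x ≡ v × x mod t ≡ k
  tableAt≡just {v} eq with offset (offset⁻¹ v) ≟ v | eq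
  ... | yes o≡v | refl = offset⁻¹ v , o≡v , refl
  ... | no  _   | ()

  -- At dinner d supplier i stands at position d + r ∸ i; if that position is the
  -- offset of some x, he sits at table x mod t.
  supplierTable : ℕ → ℕ → Maybe (Fin t)
  supplierTable d i = tableAt (d + r ∸ i)

  supplierTable-offset : ∀ {d i x} → offset x + i ≡ d + r → supplierTable d i ≡ just (x mod t)
  supplierTable-offset {d} {i} {x} eq =
    trans (cong tableAt (trans (cong (_∸ i) (sym eq)) (m+n∸n≡m (offset x) i))) (tableAt-offset x)

  supplierTable≡just : ∀ {d i k} → i < s → supplierTable d i ≡ just k →
    Σ ℕ λ x → offset x + i ≡ d + r × x mod t ≡ k
  supplierTable≡just {d} {i} i<s eq with tableAt≡just eq
  ... | x , o≡v , x≡k = x , trans (cong (_+ i) o≡v) (m∸n+n≡m i≤d+r) , x≡k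
    where
    i≤d+r : i ≤ d + r
    i≤d+r = ≤-trans (<⇒≤ (<-≤-trans i<s s≤r)) (m≤n+m r d)

  supplierTable-injective : ∀ {d i i′ k} → i < s → i′ < s →
    supplierTable d i ≡ just k → supplierTable d i′ ≡ just k → i ≡ i′
  supplierTable-injective i<s i′<s eq eq′ with supplierTable≡just i<s eq | supplierTable≡just i′<s eq′
  ... | x , ox+i , x≡k | x′ , ox′+i′ , x′≡k =
    +-cancelˡ-≡ (offset x) _ _ (trans ox+i (sym (trans (cong (λ y → offset y + _) x≡x′) ox′+i′)))
    where
    x≡x′ : x ≡ x′
    x≡x′ = offset-window-injective i<s i′<s (trans ox+i (sym ox′+i′)) (mod≡⇒%≡ (trans x≡k (sym x′≡k)))

  -- the copy of g whose offset lies in (d, d + r], when g < m and d < r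
  lift : ℕ → ℕ → ℕ
  lift d g with offset g ≤? d
  ... | yes _ = g + m
  ... | no  _ = g

  lift%m : ∀ d {g} → g < m → lift d g % m ≡ g
  lift%m d {g} g<m with offset g ≤? d
  ... | yes _ = trans ([m+n]%n≡m%n g m) (m<n⇒m%n≡m g<m)
  ... | no  _ = m<n⇒m%n≡m g<m

  offset-lift≤ : ∀ d {g} → g < m → offset (lift d g) ≤ d + r
  offset-lift≤ d {g} g<m with offset g ≤? d
  ... | yes og≤d = subst (_≤ d + r) (sym (offset-+m g)) (+-monoˡ-≤ r og≤d)
  ... | no  _    = ≤-trans (<⇒≤ (offset<r g<m)) (m≤n+m r d)

  -- the supplier facing group g at dinner d; the group is seated only if it is < s
  partner : ℕ → ℕ → ℕ
  partner d g = d + r ∸ offset (lift d g)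

  offset-lift+partner : ∀ d {g} → g < m → offset (lift d g) + partner d g ≡ d + r
  offset-lift+partner d g<m = m+[n∸m]≡n (offset-lift≤ d g<m)

  partner-≤ : ∀ {d g} → offset g ≤ d → partner d g ≡ d ∸ offset g
  partner-≤ {d} {g} og≤d with offset g ≤? d
  ... | no og≰d = contradiction og≤d og≰d
  ... | yes _   = begin
    d + r ∸ offset (g + m)  ≡⟨ cong (d + r ∸_) (trans (offset-+m g) (+-comm (offset g) r)) ⟩
    d + r ∸ (r + offset g)  ≡⟨ cong (_∸ (r + offset g)) (+-comm d r) ⟩
    r + d ∸ (r + offset g)  ≡⟨ [m+n]∸[m+o]≡n∸o r d (offset g) ⟩
    d ∸ offset g            ∎
    where open ≡-Reasoning

  partner-> : ∀ {d g} → d < offset g → partner d g ≡ d + r ∸ offset g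
  partner-> {d} {g} d<og with offset g ≤? d
  ... | yes og≤d = contradiction og≤d (<⇒≱ d<og)
  ... | no  _    = refl

  partner≡⇒dinner : ∀ {d g i} → d < r → g < m → partner d g ≡ i → (offset g + i) % r ≡ d
  partner≡⇒dinner {d} {g} {i} d<r g<m p≡i with ≤-<-connex (offset g) d
  ... | inj₁ og≤d = begin
    (offset g + i) % r                   ≡⟨ cong (λ i → (offset g + i) % r) (trans (sym p≡i) (partner-≤ og≤d)) ⟩
    (offset g + (d ∸ offset g)) % r      ≡⟨ cong (_% r) (m+[n∸m]≡n og≤d) ⟩
    d % r                                ≡⟨ m<n⇒m%n≡m d<r ⟩
    d                                    ∎
    where open ≡-Reasoning
  ... | inj₂ d<og = begin
    (offset g + i) % r                   ≡⟨ cong (λ i → (offset g + i) % r) (trans (sym p≡i) (partner-> d<og)) ⟩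
    (offset g + (d + r ∸ offset g)) % r  ≡⟨ cong (_% r) (m+[n∸m]≡n (≤-trans (<⇒≤ (offset<r g<m)) (m≤n+m r d))) ⟩
    (d + r) % r                          ≡⟨ [m+n]%n≡m%n d r ⟩
    d % r                                ≡⟨ m<n⇒m%n≡m d<r ⟩
    d                                    ∎
    where open ≡-Reasoning

  partner-exists : ∀ {g i} → g < m → i < r → Σ ℕ λ d → d < r × partner d g ≡ i
  partner-exists {g} {i} g<m i<r with offset g + i <? r
  ... | yes og+i<r =
    offset g + i , og+i<r , trans (partner-≤ {offset g + i} {g} (m≤m+n _ i)) (m+n∸m≡n (offset g) i)
  ... | no  og+i≮r = d , <-trans d<og (offset<r g<m) , (begin
    partner d g              ≡⟨ partner-> {d} {g} d<og ⟩
    d + r ∸ offset g         ≡⟨ cong (_∸ offset g) d+r≡og+i ⟩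
    offset g + i ∸ offset g  ≡⟨ m+n∸m≡n (offset g) i ⟩
    i                        ∎)
    where
    open ≡-Reasoning
    d = offset g + i ∸ r
    d+r≡og+i : d + r ≡ offset g + i
    d+r≡og+i = m∸n+n≡m (≮⇒≥ og+i≮r)
    d<og : d < offset g
    d<og = +-cancelʳ-< r d (offset g) (subst (_< offset g + r) (sym d+r≡og+i) (+-monoʳ-< (offset g) i<r))

  partner-injective : ∀ {d g g′} → g < m → g′ < m → partner d g ≡ partner d g′ → g ≡ g′
  partner-injective {d} {g} {g′} g<m g′<m p≡p′ = begin
    g              ≡⟨ sym (lift%m d g<m) ⟩
    lift d g % m   ≡⟨ cong (_% m) lift≡lift′ ⟩
    lift d g′ % m  ≡⟨ lift%m d g′<m ⟩
    g′             ∎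
    where
    open ≡-Reasoning
    offset≡ : offset (lift d g) ≡ offset (lift d g′)
    offset≡ = +-cancelʳ-≡ (partner d g) _ _ (trans (offset-lift+partner d g<m)
                (sym (trans (cong (offset (lift d g′) +_) p≡p′) (offset-lift+partner d g′<m))))
    lift≡lift′ : lift d g ≡ lift d g′
    lift≡lift′ = trans (sym (offset⁻¹-offset _)) (trans (cong offset⁻¹ offset≡) (offset⁻¹-offset _))

  group : Fin c → ℕ
  group j = toℕ j / γ

  group<m : ∀ j → group j < m
  group<m j = m<n*o⇒m/o<n (<-≤-trans (toℕ<n j) c≤m*γ)

  customerTable : ℕ → Fin c → Maybe (Fin t)
  customerTable d j with partner d (group j) <? s
  ... | yes _ = supplierTable d (partner d (group j))
  ... | no  _ = nothing

  customerTable-partner : ∀ {d j} → partner d (group j) < s →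
    customerTable d j ≡ supplierTable d (partner d (group j))
  customerTable-partner {d} {j} p<s with partner d (group j) <? s
  ... | yes _   = refl
  ... | no  p≮s = contradiction p<s p≮s

  customerTable≡just : ∀ {d j k} → customerTable d j ≡ just k →
    partner d (group j) < s × supplierTable d (partner d (group j)) ≡ just k
  customerTable≡just {d} {j} eq with partner d (group j) <? s | eq
  ... | yes p<s | eq′ = p<s , eq′
  ... | no  _   | ()

  customerTable-sameGroup : ∀ {d j j′ k} → customerTable d j ≡ just k → customerTable d j′ ≡ just k →
    group j ≡ group j′
  customerTable-sameGroup {j = j} {j′} eq eq′ with customerTable≡just eq | customerTable≡just eq′
  ... | p<s , e | p′<s , e′ = partner-injective (group<m j) (group<m j′) (supplierTable-injective p<s p′<s e e′)

  meets⇒partner : ∀ {d i j} → i < s → T (sameTable (supplierTable d i) (customerTable d j)) →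
    partner d (group j) ≡ i
  meets⇒partner i<s meet with sameTable⇒just meet
  ... | _ , sup≡k , cust≡k with customerTable≡just cust≡k
  ...   | p<s , sup′≡k = supplierTable-injective p<s i<s sup′≡k sup≡k

  partner⇒meets : ∀ {d i j} → i < s → partner d (group j) ≡ i →
    T (sameTable (supplierTable d i) (customerTable d j))
  partner⇒meets {d} {j = j} p<s refl
    rewrite customerTable-partner {d} {j} p<s
          | supplierTable-offset {d} {partner d (group j)} {lift d (group j)}
              (offset-lift+partner d (group<m j))
    = sameTable-refl _

  dinner : ℕ → Dinner t s c
  dinner d = record { supSeat = supplierTable d ∘ toℕ ; custSeat = customerTable d }

  schedule : Schedule t s c
  schedule = applyDownFrom dinner r

  dinner-respectsCapacity : ∀ d → RespectsCapacity 1 γ (dinner d)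
  dinner-respectsCapacity d k =
    countFin-atMostOne s _ (λ i i′ at at′ → toℕ-injective
      (supplierTable-injective (toℕ<n i) (toℕ<n i′) (atTable⇒≡just _ at) (atTable⇒≡just _ at′))) ,
    countFin-block c _ γ (λ j j′ at at′ → customerTable-sameGroup (atTable⇒≡just _ at) (atTable⇒≡just _ at′))

  suppliersNeverMeet : ∀ i i′ → i ≢ i′ → supMeetings schedule i i′ ≡ 0
  suppliersNeverMeet i i′ i≢i′ = countList-applyDownFrom-none _ dinner r λ _ meet →
    let _ , e , e′ = sameTable⇒just meet in
    i≢i′ (toℕ-injective (supplierTable-injective (toℕ<n i) (toℕ<n i′) e e′))

  meetsOnce : ∀ i j → scMeetings schedule i j ≡ 1
  meetsOnce i j with partner-exists (group<m j) (<-≤-trans (toℕ<n i) s≤r)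
  ... | d₀ , d₀<r , p≡i = countList-applyDownFrom-unique (λ D → sameTable (supSeat D i) (custSeat D j)) dinner
    d₀<r (partner⇒meets (toℕ<n i) p≡i) λ d<r meet →
      trans (sym (partner≡⇒dinner d<r (group<m j) (meets⇒partner (toℕ<n i) meet)))
            (partner≡⇒dinner d₀<r (group<m j) p≡i)

  feasibleSchedule : Σ (Schedule t s c) λ S → Feasible 1 γ S × length S ≡ r
  feasibleSchedule =
    schedule ,
    (applyDownFrom⁺₂ dinner r dinner-respectsCapacity ,
     (λ i i′ i≢i′ → ≤-trans (≤-reflexive (suppliersNeverMeet i i′ i≢i′)) z≤n) ,
     meetsOnce) ,
    length-applyDownFrom dinner r

proposition3p1 : (t s c γ : ℕ) → .{{_ : NonZero t}} → .{{_ : NonZero s}} → .{{_ : NonZero c}} → .{{_ : NonZero γ}} →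
    IsOptimalDinnerCount t s c 1 γ (s ⊔ ⌈ c / γ ⌉ ⊔ ⌈ s * ⌈ c / γ ⌉ / t ⌉)
proposition3p1 t s c γ =
  Construction.feasibleSchedule t s c γ m r s≤r m≤r s*m≤r*t (m≤⌈m/n⌉*n c γ) , lowerBound
  where
  m = ⌈ c / γ ⌉
  r = s ⊔ m ⊔ ⌈ s * m / t ⌉
  s≤r : s ≤ r
  s≤r = ≤-trans (m≤m⊔n s m) (m≤m⊔n _ _)
  m≤r : m ≤ r
  m≤r = ≤-trans (m≤n⊔m s m) (m≤m⊔n _ _)
  s*m≤r*t : s * m ≤ r * t
  s*m≤r*t = ≤-trans (m≤⌈m/n⌉*n (s * m) t) (*-monoˡ-≤ t (m≤n⊔m (s ⊔ m) _))
  instance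
    m-nonZero : NonZero m
    m-nonZero = >-nonZero (⌈m/n⌉>0 (>-nonZero⁻¹ c))
    r-nonZero : NonZero r
    r-nonZero = >-nonZero (<-≤-trans (>-nonZero⁻¹ s) s≤r)
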